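{- Let $k \geq 2$ and $n,\alpha,\beta \geq 0$ be integers. Then $$C^k_{n,(\alpha,\beta)} = \left( \sum_{i \geq 0} (-1)^i \frac{\beta+1}{k(n-i)+\beta+1} \binom{k(n-i)+\beta+1}{n-i} \binom{\alpha-(k-1)i}{i} \right) - (-1)^n \binom{\alpha-\beta-1-(k-1)n}{n}.$$
   Context: For an integer $k\ge 2$ and integers $\alpha,\beta\ge 0$, $n \ge 0$, a raised $k$-Dyck path of shape $(\alpha,\beta)$ is an integer lattice path from $(0,\alpha)$ to $(kn+\beta-\alpha,\beta)$ using steps $U=(1,1)$ and $D=(1,1-k)$ that stays weakly above the line $y=0$; such a path has exactly $n$ steps $D$ and $n+\beta-\alpha$ steps $U$. Let $\mathcal{D}^k_{n,(\alpha,\beta)}$ be the set of these paths and $C^k_{n,(\alpha,\beta)} = |\mathcal{D}^k_{n,(\alpha,\beta)}|$ (the empty path counts when $n=0$, $\alpha=\beta$; the count is $0$ if $kn+\beta-\alpha<0$). Convention: $\binom{a}{b}=0$ whenever $a<0$ or $b<0$ (so all terms of the sum with $i>n$ vanish). -}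

module Defs where

open import Data.Nat as ℕ using (ℕ; zero; suc; _∸_; _<ᵇ_)
open import Data.Nat.Combinatorics using (_C_)
open import Data.Integer as ℤ using (ℤ; +_; -[1+_]; _≤ᵇ_)
open import Data.Rational as ℚ using (ℚ; _/_)
open import Data.Bool using (Bool; true; false; _∧_; if_then_else_)
open import Data.List using (List; []; _∷_; map; _++_; filterᵇ; length; upTo)

-- Steps of a k-Dyck path: U = (1,1), D = (1,1-k)
data Step : Set where
  U D : Step

δ : ℕ → Step → ℤ
δ k U = + 1
δ k D = + 1 ℤ.- + k

words : ℕ → List (List Step)
words zero    = [] ∷ []
words (suc L) = map (U ∷_) (words L) ++ map (D ∷_) (words L)

staysAboveEndsAt : ℕ → ℤ → ℤ → List Step → Bool
staysAboveEndsAt k h β []      = (h ℤ.≤ᵇ β) ∧ (β ℤ.≤ᵇ h)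
staysAboveEndsAt k h β (s ∷ w) =
  (+ 0 ≤ᵇ (h ℤ.+ δ k s)) ∧ staysAboveEndsAt k (h ℤ.+ δ k s) β w

countD : List Step → ℕ
countD []      = 0
countD (U ∷ w) = countD w
countD (D ∷ w) = suc (countD w)

isDyck : ℕ → ℕ → ℕ → ℕ → List Step → Bool
isDyck k n α β w =
  staysAboveEndsAt k (+ α) (+ β) w ∧ (countD w ℕ.≡ᵇ n)

-- C^k_{n,(α,β)}: number of raised k-Dyck paths from (0,α) to (kn+β-α, β)
-- with n down steps; 0 if kn+β-α < 0.
dyckCount : ℕ → ℕ → ℕ → ℕ → ℕ
dyckCount k n α β =
  if (k ℕ.* n ℕ.+ β) <ᵇ α then 0
  else length (filterᵇ (isDyck k n α β) (words (k ℕ.* n ℕ.+ β ∸ α)))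

-- binomial with integer top; 0 when the top is negative
binomℤ : ℤ → ℕ → ℕ
binomℤ (+ m)    b = m C b
binomℤ -[1+ m ] b = 0

sgn : ℕ → ℤ
sgn zero          = + 1
sgn (suc zero)    = ℤ.- + 1
sgn (suc (suc i)) = sgn i

sumℚ : ℕ → (ℕ → ℚ) → ℚ
sumℚ zero    f = f 0
sumℚ (suc n) f = sumℚ n f ℚ.+ f (suc n)

summand : ℕ → ℕ → ℕ → ℕ → ℕ → ℚ
summand k n α β i =
  let j = n ∸ i in
  ((sgn i / 1) ℚ.* ((+ (suc β ℕ.* (suc (k ℕ.* j ℕ.+ β) C j))) / suc (k ℕ.* j ℕ.+ β)))
    ℚ.* ((+ binomℤ (+ α ℤ.- + ((k ∸ 1) ℕ.* i)) i) / 1)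

rhs : ℕ → ℕ → ℕ → ℕ → ℚ
rhs k n α β =
  sumℚ n (summand k n α β)
    ℚ.- ((sgn n ℤ.* + binomℤ (+ α ℤ.- + β ℤ.- + 1 ℤ.- + ((k ∸ 1) ℕ.* n)) n) / 1)

-- Write k = K + 1. As functions of (n, β), for fixed α, both sides satisfy
--   f (n + 1) (β + 1) = f (n + 1) β + f n (K + β + 1)   and   f (n + 1) 0 = f n K,
-- and they agree at n = 0; this determines them. For paths the recurrence is the
-- decomposition by the last step, which enters height β + 1 from β (a U) or from
-- K + β + 1 (a D), and height 0 only from K. For the right-hand side it is Pascal's
-- rule, once the ballot number (β + 1)/(kj + β + 1) · C(kj + β + 1, j) is written as
-- C(kj + β, j) − K · C(kj + β, j − 1); the case of height 0 uses that this expression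
-- vanishes at β = −1 when j ≥ 1.
module Submission where

open import Data.Nat as ℕ using (ℕ; zero; suc; _∸_; _≥_)
import Data.Nat.Properties as ℕₚ
open import Data.Nat.Combinatorics using (_C_; nC1≡n; nCk+nC[k+1]≡[n+1]C[k+1])
import Data.Nat.Tactic.RingSolver as ℕ-Solver
open import Data.Integer as ℤ using (ℤ; +_; -[1+_]; _+_; _*_; _-_; -_)
import Data.Integer.Properties as ℤₚ
import Data.Integer.Tactic.RingSolver as ℤ-Solver
open import Data.Rational as ℚ using (ℚ; _/_)
import Data.Rational.Properties as ℚₚ
import Data.Rational.Unnormalised as ℚᵘ
open ℚᵘ using (mkℚᵘ; *≡*)
import Data.Rational.Unnormalised.Properties as ℚᵘₚ
open import Data.Bool using (Bool; true; false; not; _∧_; if_then_else_; T)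
open import Data.Bool.Properties using (T?)
import Data.Bool.Properties as Boolₚ
open import Data.List using ([]; _∷_; _++_; map; length; filterᵇ)
import Data.List.Properties as Listₚ
import Data.List.Relation.Unary.All as All
open import Data.Product using (_,_)
open import Function using (_∘_; Equivalence)
open import Relation.Nullary using (yes; no)
open import Relation.Binary.PropositionalEquality
open ≡-Reasoning

open import Defs

[k+1]*[n+1]C[k+1]≡[n+1]*nCk : ∀ n k → suc k ℕ.* (suc n C suc k) ≡ suc n ℕ.* (n C k)
[k+1]*[n+1]C[k+1]≡[n+1]*nCk zero    zero    = refl
[k+1]*[n+1]C[k+1]≡[n+1]*nCk zero    (suc k) = ℕₚ.*-zeroʳ (suc (suc k))
[k+1]*[n+1]C[k+1]≡[n+1]*nCk (suc n) zero    =
  trans (ℕₚ.+-identityʳ _) (trans (nC1≡n (suc (suc n))) (sym (ℕₚ.*-identityʳ (suc (suc n)))))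
[k+1]*[n+1]C[k+1]≡[n+1]*nCk (suc n) (suc k) = begin
  suc (suc k) ℕ.* (suc (suc n) C suc (suc k))
    ≡⟨ cong (suc (suc k) ℕ.*_) (sym (nCk+nC[k+1]≡[n+1]C[k+1] (suc n) (suc k))) ⟩
  suc (suc k) ℕ.* (x ℕ.+ y)
    ≡⟨ split k x y ⟩
  x ℕ.+ suc k ℕ.* x ℕ.+ suc (suc k) ℕ.* y
    ≡⟨ cong₂ (λ p q → x ℕ.+ p ℕ.+ q) ([k+1]*[n+1]C[k+1]≡[n+1]*nCk n k) ([k+1]*[n+1]C[k+1]≡[n+1]*nCk n (suc k)) ⟩
  x ℕ.+ suc n ℕ.* (n C k) ℕ.+ suc n ℕ.* (n C suc k)
    ≡⟨ merge n x (n C k) (n C suc k) ⟩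
  x ℕ.+ suc n ℕ.* (n C k ℕ.+ n C suc k)
    ≡⟨ cong (λ p → x ℕ.+ suc n ℕ.* p) (nCk+nC[k+1]≡[n+1]C[k+1] n k) ⟩
  suc (suc n) ℕ.* x ∎
  where
  open ℕ-Solver
  x = suc n C suc k
  y = suc n C suc (suc k)
  split : ∀ k x y → suc (suc k) ℕ.* (x ℕ.+ y) ≡ x ℕ.+ suc k ℕ.* x ℕ.+ suc (suc k) ℕ.* y
  split = solve-∀
  merge : ∀ n x c d → x ℕ.+ suc n ℕ.* c ℕ.+ suc n ℕ.* d ≡ x ℕ.+ suc n ℕ.* (c ℕ.+ d)
  merge = solve-∀

[k+1]*[m+k]C[k+1]≡m*[m+k]Ck : ∀ m k → suc k ℕ.* ((m ℕ.+ k) C suc k) ≡ m ℕ.* ((m ℕ.+ k) C k)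
[k+1]*[m+k]C[k+1]≡m*[m+k]Ck m k = ℕₚ.+-cancelˡ-≡ (suc k ℕ.* c) _ _ (begin
  suc k ℕ.* c ℕ.+ suc k ℕ.* d    ≡⟨ ℕₚ.*-distribˡ-+ (suc k) c d ⟨
  suc k ℕ.* (c ℕ.+ d)            ≡⟨ cong (suc k ℕ.*_) (nCk+nC[k+1]≡[n+1]C[k+1] (m ℕ.+ k) k) ⟩
  suc k ℕ.* (suc (m ℕ.+ k) C suc k) ≡⟨ [k+1]*[n+1]C[k+1]≡[n+1]*nCk (m ℕ.+ k) k ⟩
  suc (m ℕ.+ k) ℕ.* c            ≡⟨ regroup m k c ⟩
  suc k ℕ.* c ℕ.+ m ℕ.* c        ∎)
  where
  open ℕ-Solver
  c = (m ℕ.+ k) C k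
  d = (m ℕ.+ k) C suc k
  regroup : ∀ m k c → suc (m ℕ.+ k) ℕ.* c ≡ suc k ℕ.* c ℕ.+ m ℕ.* c
  regroup = solve-∀

[m+k+1]*[m+k]C[k+1]≡m*[m+k+1]C[k+1] : ∀ m k → suc (m ℕ.+ k) ℕ.* ((m ℕ.+ k) C suc k) ≡ m ℕ.* (suc (m ℕ.+ k) C suc k)
[m+k+1]*[m+k]C[k+1]≡m*[m+k+1]C[k+1] m k = begin
  suc (m ℕ.+ k) ℕ.* d            ≡⟨ regroup m k d ⟩
  suc k ℕ.* d ℕ.+ m ℕ.* d        ≡⟨ cong (ℕ._+ m ℕ.* d) ([k+1]*[m+k]C[k+1]≡m*[m+k]Ck m k) ⟩
  m ℕ.* c ℕ.+ m ℕ.* d            ≡⟨ ℕₚ.*-distribˡ-+ m c d ⟨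
  m ℕ.* (c ℕ.+ d)                ≡⟨ cong (m ℕ.*_) (nCk+nC[k+1]≡[n+1]C[k+1] (m ℕ.+ k) k) ⟩
  m ℕ.* (suc (m ℕ.+ k) C suc k)  ∎
  where
  open ℕ-Solver
  c = (m ℕ.+ k) C k
  d = (m ℕ.+ k) C suc k
  regroup : ∀ m k c → suc (m ℕ.+ k) ℕ.* c ≡ suc k ℕ.* c ℕ.+ m ℕ.* c
  regroup = solve-∀

pos-pascal : ∀ n k → + (suc n C suc k) ≡ + (n C k) + + (n C suc k)
pos-pascal n k = trans (cong +_ (sym (nCk+nC[k+1]≡[n+1]C[k+1] n k))) (ℤₚ.pos-+ (n C k) (n C suc k))

binomℤ-pascal : ∀ z n → binomℤ (z + + 1) (suc n) ≡ binomℤ z (suc n) ℕ.+ binomℤ z n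
binomℤ-pascal (+ m) n = begin
  (m ℕ.+ 1) C suc n         ≡⟨ cong (_C suc n) (ℕₚ.+-comm m 1) ⟩
  suc m C suc n             ≡⟨ nCk+nC[k+1]≡[n+1]C[k+1] m n ⟨
  m C n ℕ.+ m C suc n       ≡⟨ ℕₚ.+-comm (m C n) (m C suc n) ⟩
  m C suc n ℕ.+ m C n       ∎
binomℤ-pascal -[1+ zero ]  n = refl
binomℤ-pascal -[1+ suc m ] n = refl

binomℤ-⊖-zero : ∀ m n → binomℤ (m ℤ.⊖ n) 0 ≡ (if m ℕ.<ᵇ n then 0 else 1)
binomℤ-⊖-zero m       zero    = refl
binomℤ-⊖-zero zero    (suc n) = refl
binomℤ-⊖-zero (suc m) (suc n) = trans (cong (λ z → binomℤ z 0) (ℤₚ.[1+m]⊖[1+n]≡m⊖n m n)) (binomℤ-⊖-zero m n)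

-- Ballot numbers

ballotDiff : ℕ → ℕ → ℕ → ℤ
ballotDiff K N zero    = + 1
ballotDiff K N (suc j) = + (N C suc j) - + K * + (N C j)

ballot : ℕ → ℕ → ℕ → ℤ
ballot K j β = ballotDiff K (suc K ℕ.* j ℕ.+ β) j

ballotDiff-pascal : ∀ K M j → ballotDiff K (suc M) (suc j) ≡ ballotDiff K M (suc j) + ballotDiff K M j
ballotDiff-pascal K M zero = begin
  + (suc M C 1) - + K * + 1   ≡⟨ cong (λ x → + x - + K * + 1) (nC1≡n (suc M)) ⟩
  + suc M - + K * + 1         ≡⟨ cong (λ x → x - + K * + 1) (ℤₚ.pos-+ 1 M) ⟩
  (+ 1 + + M) - + K * + 1     ≡⟨ shift (+ M) (+ K) ⟩
  (+ M - + K * + 1) + + 1     ≡⟨ cong (λ x → (+ x - + K * + 1) + + 1) (nC1≡n M) ⟨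
  (+ (M C 1) - + K * + 1) + + 1 ∎
  where
  shift : ∀ m k → (+ 1 + m) - k * + 1 ≡ (m - k * + 1) + + 1
  shift = ℤ-Solver.solve-∀
ballotDiff-pascal K M (suc j) = begin
  + (suc M C suc (suc j)) - + K * + (suc M C suc j)
    ≡⟨ cong₂ (λ x y → x - + K * y) (pos-pascal M (suc j)) (pos-pascal M j) ⟩
  (+ b + + c) - + K * (+ a + + b)
    ≡⟨ regroup (+ a) (+ b) (+ c) (+ K) ⟩
  (+ c - + K * + b) + (+ b - + K * + a) ∎
  where
  a = M C j
  b = M C suc j
  c = M C suc (suc j)
  regroup : ∀ a b c k → (b + c) - k * (a + b) ≡ (c - k * b) + (b - k * a)
  regroup = ℤ-Solver.solve-∀

-- The ballot number at β = −1, as K (j + 1) + j = k (j + 1) − 1.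
ballotDiff-vanishes : ∀ K j → ballotDiff K (K ℕ.* suc j ℕ.+ j) (suc j) ≡ + 0
ballotDiff-vanishes K j = begin
  + (M C suc j) - + K * + (M C j)   ≡⟨ cong (λ x → + x - + K * + (M C j)) top≡K*below ⟩
  + (K ℕ.* (M C j)) - + K * + (M C j) ≡⟨ cong (_- + K * + (M C j)) (ℤₚ.pos-* K (M C j)) ⟩
  + K * + (M C j) - + K * + (M C j) ≡⟨ ℤₚ.+-inverseʳ (+ K * + (M C j)) ⟩
  + 0                               ∎
  where
  M = K ℕ.* suc j ℕ.+ j
  reassoc : ∀ K j c → K ℕ.* suc j ℕ.* c ≡ suc j ℕ.* (K ℕ.* c)
  reassoc = ℕ-Solver.solve-∀
  top≡K*below : M C suc j ≡ K ℕ.* (M C j)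
  top≡K*below = ℕₚ.*-cancelˡ-≡ _ _ (suc j)
    (trans ([k+1]*[m+k]C[k+1]≡m*[m+k]Ck (K ℕ.* suc j) j) (reassoc K j (M C j)))

ballot-suc-zero : ∀ K j → ballot K (suc j) 0 ≡ ballot K j K
ballot-suc-zero K j = begin
  ballotDiff K (suc K ℕ.* suc j ℕ.+ 0) (suc j)
    ≡⟨ cong (λ N → ballotDiff K N (suc j)) (e₁ K j) ⟩
  ballotDiff K (suc M) (suc j)
    ≡⟨ ballotDiff-pascal K M j ⟩
  ballotDiff K M (suc j) + ballotDiff K M j
    ≡⟨ cong (λ N → ballotDiff K N (suc j) + ballotDiff K M j) (e₂ K j) ⟩
  ballotDiff K (K ℕ.* suc j ℕ.+ j) (suc j) + ballotDiff K M j
    ≡⟨ cong (_+ ballotDiff K M j) (ballotDiff-vanishes K j) ⟩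
  + 0 + ballotDiff K M j
    ≡⟨ ℤₚ.+-identityˡ (ballotDiff K M j) ⟩
  ballot K j K ∎
  where
  M = suc K ℕ.* j ℕ.+ K
  e₁ : ∀ K j → suc K ℕ.* suc j ℕ.+ 0 ≡ suc (suc K ℕ.* j ℕ.+ K)
  e₁ = ℕ-Solver.solve-∀
  e₂ : ∀ K j → suc K ℕ.* j ℕ.+ K ≡ K ℕ.* suc j ℕ.+ j
  e₂ = ℕ-Solver.solve-∀

ballot-suc-suc : ∀ K j b → ballot K (suc j) (suc b) ≡ ballot K (suc j) b + ballot K j (K ℕ.+ suc b)
ballot-suc-suc K j b = begin
  ballotDiff K (suc K ℕ.* suc j ℕ.+ suc b) (suc j)
    ≡⟨ cong (λ N → ballotDiff K N (suc j)) (ℕₚ.+-suc (suc K ℕ.* suc j) b) ⟩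
  ballotDiff K (suc S) (suc j)
    ≡⟨ ballotDiff-pascal K S j ⟩
  ballotDiff K S (suc j) + ballotDiff K S j
    ≡⟨ cong (λ N → ballot K (suc j) b + ballotDiff K N j) (e K j b) ⟩
  ballot K (suc j) b + ballot K j (K ℕ.+ suc b) ∎
  where
  S = suc K ℕ.* suc j ℕ.+ b
  e : ∀ K j b → suc K ℕ.* suc j ℕ.+ b ≡ suc K ℕ.* j ℕ.+ (K ℕ.+ suc b)
  e = ℕ-Solver.solve-∀

ballot-numerator : ∀ K i β → let N = suc K ℕ.* suc i ℕ.+ β in
  suc N ℕ.* (N C suc i) ≡ suc β ℕ.* (suc N C suc i) ℕ.+ K ℕ.* (suc N ℕ.* (N C i))
ballot-numerator K i β = subst statement (sym (N≡m+i K i β)) (begin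
  suc (m ℕ.+ i) ℕ.* ((m ℕ.+ i) C suc i)
    ≡⟨ [m+k+1]*[m+k]C[k+1]≡m*[m+k+1]C[k+1] m i ⟩
  m ℕ.* X
    ≡⟨ split K i β X ⟩
  suc β ℕ.* X ℕ.+ K ℕ.* (suc i ℕ.* X)
    ≡⟨ cong (λ y → suc β ℕ.* X ℕ.+ K ℕ.* y) ([k+1]*[n+1]C[k+1]≡[n+1]*nCk (m ℕ.+ i) i) ⟩
  suc β ℕ.* X ℕ.+ K ℕ.* (suc (m ℕ.+ i) ℕ.* ((m ℕ.+ i) C i)) ∎)
  where
  statement : ℕ → Set
  statement N = suc N ℕ.* (N C suc i) ≡ suc β ℕ.* (suc N C suc i) ℕ.+ K ℕ.* (suc N ℕ.* (N C i))
  m = suc (K ℕ.* suc i ℕ.+ β)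
  X = suc (m ℕ.+ i) C suc i
  N≡m+i : ∀ K i β → suc K ℕ.* suc i ℕ.+ β ≡ suc (K ℕ.* suc i ℕ.+ β) ℕ.+ i
  N≡m+i = ℕ-Solver.solve-∀
  split : ∀ K i β X → suc (K ℕ.* suc i ℕ.+ β) ℕ.* X ≡ suc β ℕ.* X ℕ.+ K ℕ.* (suc i ℕ.* X)
  split = ℕ-Solver.solve-∀

ballot-spec : ∀ K j β → let N = suc K ℕ.* j ℕ.+ β in
  + (suc β ℕ.* (suc N C j)) ≡ ballot K j β * + suc N
ballot-spec K zero β = begin
  + (suc β ℕ.* 1)               ≡⟨ cong +_ (ℕₚ.*-identityʳ (suc β)) ⟩
  + suc β                       ≡⟨ cong (λ x → + suc x) (e K β) ⟨
  + suc (suc K ℕ.* 0 ℕ.+ β)     ≡⟨ ℤₚ.*-identityˡ _ ⟨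
  + 1 * + suc (suc K ℕ.* 0 ℕ.+ β) ∎
  where
  e : ∀ K β → suc K ℕ.* 0 ℕ.+ β ≡ β
  e = ℕ-Solver.solve-∀
ballot-spec K (suc i) β = begin
  + (suc β ℕ.* X)
    ≡⟨ subtract (ballot-numerator K i β) ⟩
  + (suc N ℕ.* d) - + (K ℕ.* (suc N ℕ.* c))
    ≡⟨ cong₂ _-_ (ℤₚ.pos-* (suc N) d) (trans (ℤₚ.pos-* K _) (cong (+ K *_) (ℤₚ.pos-* (suc N) c))) ⟩
  + suc N * + d - + K * (+ suc N * + c)
    ≡⟨ regroup (+ suc N) (+ d) (+ c) (+ K) ⟩
  (+ d - + K * + c) * + suc N ∎
  where
  N = suc K ℕ.* suc i ℕ.+ β
  X = suc N C suc i
  c = N C i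
  d = N C suc i
  add-sub : ∀ a b → a ≡ a + b - b
  add-sub = ℤ-Solver.solve-∀
  subtract : ∀ {x y z} → x ≡ y ℕ.+ z → + y ≡ + x - + z
  subtract {x} {y} {z} refl = begin
    + y                  ≡⟨ add-sub (+ y) (+ z) ⟩
    + y + + z - + z      ≡⟨ cong (_- + z) (ℤₚ.pos-+ y z) ⟨
    + (y ℕ.+ z) - + z    ∎
  regroup : ∀ n d c k → n * d - k * (n * c) ≡ (d - k * c) * n
  regroup = ℤ-Solver.solve-∀

-- The right-hand side over ℤ

sgn-suc : ∀ n → sgn (suc n) ≡ - sgn n
sgn-suc zero          = refl
sgn-suc (suc zero)    = refl
sgn-suc (suc (suc n)) = sgn-suc n

alternating-pascal : ∀ m n →
  sgn (suc n) * + binomℤ (m + + 1) (suc n) + sgn n * + binomℤ m n ≡ sgn (suc n) * + binomℤ m (suc n)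
alternating-pascal m n = begin
  sgn (suc n) * + binomℤ (m + + 1) (suc n) + sgn n * + c
    ≡⟨ cong₂ (λ s x → s * x + sgn n * + c) (sgn-suc n) (trans (cong +_ (binomℤ-pascal m n)) (ℤₚ.pos-+ d c)) ⟩
  - sgn n * (+ d + + c) + sgn n * + c
    ≡⟨ cancel (sgn n) (+ d) (+ c) ⟩
  - sgn n * + d
    ≡⟨ cong (_* + d) (sgn-suc n) ⟨
  sgn (suc n) * + d ∎
  where
  c = binomℤ m n
  d = binomℤ m (suc n)
  cancel : ∀ s d c → - s * (d + c) + s * c ≡ - s * d
  cancel = ℤ-Solver.solve-∀

sumℤ : ℕ → (ℕ → ℤ) → ℤ
sumℤ zero    f = f 0
sumℤ (suc n) f = sumℤ n f + f (suc n)

sumℤ-cong : ∀ n {f g : ℕ → ℤ} → (∀ {i} → i ℕ.≤ n → f i ≡ g i) → sumℤ n f ≡ sumℤ n g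
sumℤ-cong zero    f≗g = f≗g ℕ.z≤n
sumℤ-cong (suc n) f≗g = cong₂ _+_ (sumℤ-cong n (λ i≤n → f≗g (ℕₚ.m≤n⇒m≤1+n i≤n))) (f≗g ℕₚ.≤-refl)

sumℤ-+ : ∀ n (f g : ℕ → ℤ) → sumℤ n (λ i → f i + g i) ≡ sumℤ n f + sumℤ n g
sumℤ-+ zero    f g = refl
sumℤ-+ (suc n) f g = trans (cong (_+ (f (suc n) + g (suc n))) (sumℤ-+ n f g))
                           (interchange (sumℤ n f) (sumℤ n g) (f (suc n)) (g (suc n)))
  where
  interchange : ∀ a b c d → (a + b) + (c + d) ≡ (a + c) + (b + d)
  interchange = ℤ-Solver.solve-∀

startBinom : ℕ → ℕ → ℕ → ℤ
startBinom K α i = + binomℤ (+ α - + (K ℕ.* i)) i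

term : ℕ → ℕ → ℕ → ℕ → ℕ → ℤ
term K n α β i = sgn i * ballot K (n ∸ i) β * startBinom K α i

correction : ℕ → ℕ → ℕ → ℕ → ℤ
correction K n α β = sgn n * + binomℤ (+ α - + β - + 1 - + (K ℕ.* n)) n

rhsℤ : ℕ → ℕ → ℕ → ℕ → ℤ
rhsℤ K n α β = sumℤ n (term K n α β) - correction K n α β

term-last : ∀ K n α β → term K n α β n ≡ sgn n * startBinom K α n
term-last K n α β rewrite ℕₚ.n∸n≡0 n = cong (_* startBinom K α n) (ℤₚ.*-identityʳ (sgn n))

term-suc-suc : ∀ K n α b {i} → i ℕ.≤ n →
  term K (suc n) α (suc b) i ≡ term K (suc n) α b i + term K n α (K ℕ.+ suc b) i
term-suc-suc K n α b {i} i≤n rewrite ℕₚ.+-∸-assoc 1 i≤n =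
  trans (cong (λ x → sgn i * x * startBinom K α i) (ballot-suc-suc K (n ∸ i) b))
        (distrib (sgn i) (ballot K (suc (n ∸ i)) b) (ballot K (n ∸ i) (K ℕ.+ suc b)) (startBinom K α i))
  where
  distrib : ∀ s x y c → s * (x + y) * c ≡ s * x * c + s * y * c
  distrib = ℤ-Solver.solve-∀

term-suc-zero : ∀ K n α {i} → i ℕ.≤ n → term K (suc n) α 0 i ≡ term K n α K i
term-suc-zero K n α {i} i≤n rewrite ℕₚ.+-∸-assoc 1 i≤n =
  cong (λ x → sgn i * x * startBinom K α i) (ballot-suc-zero K (n ∸ i))

sum-suc-suc : ∀ K n α b → sumℤ (suc n) (term K (suc n) α (suc b))
  ≡ sumℤ (suc n) (term K (suc n) α b) + sumℤ n (term K n α (K ℕ.+ suc b))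
sum-suc-suc K n α b = begin
  sumℤ n (term K (suc n) α (suc b)) + term K (suc n) α (suc b) (suc n)
    ≡⟨ cong₂ _+_ (trans (sumℤ-cong n (term-suc-suc K n α b)) (sumℤ-+ n _ _))
                 (trans (term-last K (suc n) α (suc b)) (sym (term-last K (suc n) α b))) ⟩
  (sumℤ n (term K (suc n) α b) + sumℤ n (term K n α (K ℕ.+ suc b))) + term K (suc n) α b (suc n)
    ≡⟨ swap (sumℤ n (term K (suc n) α b)) _ _ ⟩
  (sumℤ n (term K (suc n) α b) + term K (suc n) α b (suc n)) + sumℤ n (term K n α (K ℕ.+ suc b)) ∎
  where
  swap : ∀ a b c → (a + b) + c ≡ (a + c) + b
  swap = ℤ-Solver.solve-∀

sum-suc-zero : ∀ K n α →
  sumℤ (suc n) (term K (suc n) α 0) ≡ sumℤ n (term K n α K) + sgn (suc n) * startBinom K α (suc n)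
sum-suc-zero K n α = cong₂ _+_ (sumℤ-cong n (term-suc-zero K n α)) (term-last K (suc n) α 0)

pos-*-suc : ∀ K n → + (K ℕ.* suc n) ≡ + K + + (K ℕ.* n)
pos-*-suc K n = trans (cong +_ (ℕₚ.*-suc K n)) (ℤₚ.pos-+ K (K ℕ.* n))

correction-suc-suc : ∀ K n α b →
  correction K (suc n) α (suc b) ≡ correction K (suc n) α b + correction K n α (K ℕ.+ suc b)
correction-suc-suc K n α b = sym (begin
  sgn (suc n) * + binomℤ (+ α - + b - + 1 - + (K ℕ.* suc n)) (suc n)
    + sgn n * + binomℤ (+ α - + (K ℕ.+ suc b) - + 1 - + (K ℕ.* n)) n
    ≡⟨ cong₂ (λ x y → sgn (suc n) * + binomℤ x (suc n) + sgn n * + binomℤ y n) top₁ top₂ ⟩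
  sgn (suc n) * + binomℤ (m + + 1) (suc n) + sgn n * + binomℤ m n
    ≡⟨ alternating-pascal m n ⟩
  sgn (suc n) * + binomℤ m (suc n) ∎)
  where
  m = + α - + suc b - + 1 - + (K ℕ.* suc n)
  top₁ : + α - + b - + 1 - + (K ℕ.* suc n) ≡ m + + 1
  top₁ = begin
    + α - + b - + 1 - + (K ℕ.* suc n)            ≡⟨ shift (+ α) (+ b) (+ (K ℕ.* suc n)) ⟩
    + α - (+ 1 + + b) - + 1 - + (K ℕ.* suc n) + + 1
      ≡⟨ cong (λ x → + α - x - + 1 - + (K ℕ.* suc n) + + 1) (ℤₚ.pos-+ 1 b) ⟨
    m + + 1                                      ∎
    where
    shift : ∀ a b x → a - b - + 1 - x ≡ a - (+ 1 + b) - + 1 - x + + 1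
    shift = ℤ-Solver.solve-∀
  top₂ : + α - + (K ℕ.+ suc b) - + 1 - + (K ℕ.* n) ≡ m
  top₂ = begin
    + α - + (K ℕ.+ suc b) - + 1 - + (K ℕ.* n)    ≡⟨ cong (λ x → + α - x - + 1 - + (K ℕ.* n)) (ℤₚ.pos-+ K (suc b)) ⟩
    + α - (+ K + + suc b) - + 1 - + (K ℕ.* n)    ≡⟨ move (+ α) (+ K) (+ suc b) (+ (K ℕ.* n)) ⟩
    + α - + suc b - + 1 - (+ K + + (K ℕ.* n))    ≡⟨ cong (λ x → + α - + suc b - + 1 - x) (pos-*-suc K n) ⟨
    m                                            ∎
    where
    move : ∀ a k b x → a - (k + b) - + 1 - x ≡ a - b - + 1 - (k + x)
    move = ℤ-Solver.solve-∀

correction-suc-zero : ∀ K n α →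
  correction K (suc n) α 0 ≡ correction K n α K + sgn (suc n) * startBinom K α (suc n)
correction-suc-zero K n α = sym (begin
  sgn n * + binomℤ (+ α - + K - + 1 - + (K ℕ.* n)) n
    + sgn (suc n) * + binomℤ (+ α - + (K ℕ.* suc n)) (suc n)
    ≡⟨ cong₂ (λ x y → sgn n * + binomℤ x n + sgn (suc n) * + binomℤ y (suc n)) top₁ top₂ ⟩
  sgn n * + binomℤ m n + sgn (suc n) * + binomℤ (m + + 1) (suc n)
    ≡⟨ ℤₚ.+-comm (sgn n * + binomℤ m n) _ ⟩
  sgn (suc n) * + binomℤ (m + + 1) (suc n) + sgn n * + binomℤ m n
    ≡⟨ alternating-pascal m n ⟩
  sgn (suc n) * + binomℤ m (suc n) ∎)
  where
  m = + α - + 0 - + 1 - + (K ℕ.* suc n)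
  top₁ : + α - + K - + 1 - + (K ℕ.* n) ≡ m
  top₁ = begin
    + α - + K - + 1 - + (K ℕ.* n)            ≡⟨ move (+ α) (+ K) (+ (K ℕ.* n)) ⟩
    + α - + 0 - + 1 - (+ K + + (K ℕ.* n))    ≡⟨ cong (λ x → + α - + 0 - + 1 - x) (pos-*-suc K n) ⟨
    m                                        ∎
    where
    move : ∀ a k x → a - k - + 1 - x ≡ a - + 0 - + 1 - (k + x)
    move = ℤ-Solver.solve-∀
  top₂ : + α - + (K ℕ.* suc n) ≡ m + + 1
  top₂ = shift (+ α) (+ (K ℕ.* suc n))
    where
    shift : ∀ a x → a - x ≡ a - + 0 - + 1 - x + + 1
    shift = ℤ-Solver.solve-∀

rhsℤ-suc-suc : ∀ K n α b → rhsℤ K (suc n) α (suc b) ≡ rhsℤ K (suc n) α b + rhsℤ K n α (K ℕ.+ suc b)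
rhsℤ-suc-suc K n α b =
  trans (cong₂ _-_ (sum-suc-suc K n α b) (correction-suc-suc K n α b))
        (regroup (sumℤ (suc n) (term K (suc n) α b)) (sumℤ n (term K n α (K ℕ.+ suc b)))
                 (correction K (suc n) α b) (correction K n α (K ℕ.+ suc b)))
  where
  regroup : ∀ s s′ c c′ → (s + s′) - (c + c′) ≡ (s - c) + (s′ - c′)
  regroup = ℤ-Solver.solve-∀

rhsℤ-suc-zero : ∀ K n α → rhsℤ K (suc n) α 0 ≡ rhsℤ K n α K
rhsℤ-suc-zero K n α =
  trans (cong₂ _-_ (sum-suc-zero K n α) (correction-suc-zero K n α))
        (cancel (sumℤ n (term K n α K)) (correction K n α K) (sgn (suc n) * startBinom K α (suc n)))
  where
  cancel : ∀ s c x → (s + x) - (c + x) ≡ s - c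
  cancel = ℤ-Solver.solve-∀

<ᵇ-suc : ∀ m n → (m ℕ.<ᵇ suc n) ≡ not (n ℕ.<ᵇ m)
<ᵇ-suc zero    n       = refl
<ᵇ-suc (suc m) zero    = refl
<ᵇ-suc (suc m) (suc n) = <ᵇ-suc m n

rhsℤ-zero : ∀ K α β → rhsℤ K 0 α β ≡ + (if β ℕ.<ᵇ α then 0 else 1)
rhsℤ-zero K α β = begin
  + 1 * + 1 * startBinom K α 0 - + 1 * + binomℤ (+ α - + β - + 1 - + (K ℕ.* 0)) 0
    ≡⟨ cong₂ (λ x y → + 1 * + 1 * + binomℤ (+ α - + x) 0 - + 1 * + binomℤ (+ α - + β - + 1 - + x) 0)
             (ℕₚ.*-zeroʳ K) (ℕₚ.*-zeroʳ K) ⟩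
  + 1 - + 1 * + binomℤ (+ α - + β - + 1 - + 0) 0
    ≡⟨ cong (λ z → + 1 - + 1 * + binomℤ z 0) (top (+ α) (+ β)) ⟩
  + 1 - + 1 * + binomℤ (+ α - + suc β) 0
    ≡⟨ cong (λ z → + 1 - + 1 * + binomℤ z 0) (ℤₚ.[+m]-[+n]≡m⊖n α (suc β)) ⟩
  + 1 - + 1 * + binomℤ (α ℤ.⊖ suc β) 0
    ≡⟨ cong (λ x → + 1 - + 1 * + x)
            (trans (binomℤ-⊖-zero α (suc β)) (cong (λ c → if c then 0 else 1) (<ᵇ-suc α β))) ⟩
  + 1 - + 1 * + (if not (β ℕ.<ᵇ α) then 0 else 1)
    ≡⟨ complement (β ℕ.<ᵇ α) ⟩
  + (if β ℕ.<ᵇ α then 0 else 1) ∎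
  where
  top : ∀ a b → a - b - + 1 - + 0 ≡ a - (+ 1 + b)
  top = ℤ-Solver.solve-∀
  complement : ∀ c → + 1 - + 1 * + (if not c then 0 else 1) ≡ + (if c then 0 else 1)
  complement false = refl
  complement true  = refl

fromℤ : ℤ → ℚ
fromℤ z = z / 1

toℚᵘ-fromℤ : ∀ z → ℚ.toℚᵘ (fromℤ z) ℚᵘ.≃ mkℚᵘ z 0
toℚᵘ-fromℤ z = ℚₚ.toℚᵘ-fromℚᵘ (mkℚᵘ z 0)

fromℤ-unique : ∀ {p} z → ℚ.toℚᵘ p ℚᵘ.≃ mkℚᵘ z 0 → fromℤ z ≡ p
fromℤ-unique {p} z p≃z = trans (ℚₚ.fromℚᵘ-cong (ℚᵘₚ.≃-sym p≃z)) (ℚₚ.fromℚᵘ-toℚᵘ p)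

fromℤ-+ : ∀ a b → fromℤ (a + b) ≡ fromℤ a ℚ.+ fromℤ b
fromℤ-+ a b = fromℤ-unique (a + b) (ℚᵘₚ.≃-trans (ℚₚ.toℚᵘ-homo-+ (fromℤ a) (fromℤ b))
  (ℚᵘₚ.≃-trans (ℚᵘₚ.+-cong (toℚᵘ-fromℤ a) (toℚᵘ-fromℤ b)) (*≡* (unit a b))))
  where
  unit : ∀ a b → (a * + 1 + b * + 1) * + 1 ≡ (a + b) * + 1
  unit = ℤ-Solver.solve-∀

fromℤ-* : ∀ a b → fromℤ (a * b) ≡ fromℤ a ℚ.* fromℤ b
fromℤ-* a b = fromℤ-unique (a * b) (ℚᵘₚ.≃-trans (ℚₚ.toℚᵘ-homo-* (fromℤ a) (fromℤ b))
  (ℚᵘₚ.≃-trans (ℚᵘₚ.*-cong (toℚᵘ-fromℤ a) (toℚᵘ-fromℤ b)) (*≡* refl)))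

fromℤ-neg : ∀ a → fromℤ (- a) ≡ ℚ.- fromℤ a
fromℤ-neg a = fromℤ-unique (- a) (ℚᵘₚ.≃-trans (ℚₚ.toℚᵘ-homo‿- (fromℤ a))
  (ℚᵘₚ.≃-trans (ℚᵘₚ.-‿cong (toℚᵘ-fromℤ a)) (*≡* refl)))

sumℚ≡fromℤ-sumℤ : ∀ n {g : ℕ → ℚ} {f : ℕ → ℤ} →
  (∀ i → g i ≡ fromℤ (f i)) → sumℚ n g ≡ fromℤ (sumℤ n f)
sumℚ≡fromℤ-sumℤ zero    g≗f = g≗f 0
sumℚ≡fromℤ-sumℤ (suc n) {f = f} g≗f =
  trans (cong₂ ℚ._+_ (sumℚ≡fromℤ-sumℤ n g≗f) (g≗f (suc n))) (sym (fromℤ-+ (sumℤ n f) (f (suc n))))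

ballot-ℚ : ∀ K j β → let N = suc K ℕ.* j ℕ.+ β in
  + (suc β ℕ.* (suc N C j)) / suc N ≡ fromℤ (ballot K j β)
ballot-ℚ K j β = ℚₚ.fromℚᵘ-cong {mkℚᵘ X N} {mkℚᵘ (ballot K j β) 0}
  (*≡* (trans (ℤₚ.*-identityʳ X) (ballot-spec K j β)))
  where
  N = suc K ℕ.* j ℕ.+ β
  X = + (suc β ℕ.* (suc N C j))

summand≡fromℤ-term : ∀ K n α β i → summand (suc K) n α β i ≡ fromℤ (term K n α β i)
summand≡fromℤ-term K n α β i = begin
  (fromℤ (sgn i) ℚ.* (+ (suc β ℕ.* (suc N C j)) / suc N)) ℚ.* fromℤ (startBinom K α i)
    ≡⟨ cong (λ q → (fromℤ (sgn i) ℚ.* q) ℚ.* fromℤ (startBinom K α i)) (ballot-ℚ K j β) ⟩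
  (fromℤ (sgn i) ℚ.* fromℤ (ballot K j β)) ℚ.* fromℤ (startBinom K α i)
    ≡⟨ cong (ℚ._* fromℤ (startBinom K α i)) (fromℤ-* (sgn i) (ballot K j β)) ⟨
  fromℤ (sgn i * ballot K j β) ℚ.* fromℤ (startBinom K α i)
    ≡⟨ fromℤ-* (sgn i * ballot K j β) (startBinom K α i) ⟨
  fromℤ (term K n α β i) ∎
  where
  j = n ∸ i
  N = suc K ℕ.* j ℕ.+ β

rhs≡fromℤ-rhsℤ : ∀ K n α β → rhs (suc K) n α β ≡ fromℤ (rhsℤ K n α β)
rhs≡fromℤ-rhsℤ K n α β = begin
  sumℚ n (summand (suc K) n α β) ℚ.- fromℤ (correction K n α β)
    ≡⟨ cong₂ (λ s c → s ℚ.+ c) (sumℚ≡fromℤ-sumℤ n (summand≡fromℤ-term K n α β))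
                               (sym (fromℤ-neg (correction K n α β))) ⟩
  fromℤ (sumℤ n (term K n α β)) ℚ.+ fromℤ (- correction K n α β)
    ≡⟨ fromℤ-+ (sumℤ n (term K n α β)) (- correction K n α β) ⟨
  fromℤ (rhsℤ K n α β) ∎

-- Counting paths

module _ {A : Set} where

  length-filterᵇ-++ : ∀ (p : A → Bool) xs ys →
    length (filterᵇ p (xs ++ ys)) ≡ length (filterᵇ p xs) ℕ.+ length (filterᵇ p ys)
  length-filterᵇ-++ p xs ys = trans (cong length (Listₚ.filter-++ (T? ∘ p) xs ys)) (Listₚ.length-++ (filterᵇ p xs))

  length-filterᵇ-map : ∀ (p : A → Bool) (f : A → A) xs → length (filterᵇ p (map f xs)) ≡ length (filterᵇ (p ∘ f) xs)
  length-filterᵇ-map p f []       = refl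
  length-filterᵇ-map p f (x ∷ xs) with p (f x)
  ... | true  = cong suc (length-filterᵇ-map p f xs)
  ... | false = length-filterᵇ-map p f xs

  length-filterᵇ-[x] : ∀ (p : A → Bool) x → length (filterᵇ p (x ∷ [])) ≡ (if p x then 1 else 0)
  length-filterᵇ-[x] p x with p x
  ... | true  = refl
  ... | false = refl

  length-filterᵇ-cong : ∀ {p q : A → Bool} → (∀ x → p x ≡ q x) →
    ∀ xs → length (filterᵇ p xs) ≡ length (filterᵇ q xs)
  length-filterᵇ-cong {p} {q} p≗q xs =
    cong length (Listₚ.filter-≐ (T? ∘ p) (T? ∘ q) ((λ {x} → subst T (p≗q x)) , (λ {x} → subst T (sym (p≗q x)))) xs)

  length-filterᵇ-none : ∀ {p : A → Bool} → (∀ x → p x ≡ false) → ∀ xs → length (filterᵇ p xs) ≡ 0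
  length-filterᵇ-none {p} p≗false xs =
    cong length (Listₚ.filter-none (T? ∘ p) (All.universal (λ x → subst T (p≗false x)) xs))

lower : ℕ → ℕ → (ℕ → ℕ) → ℕ
lower zero    x       f = f x
lower (suc d) zero    f = 0
lower (suc d) (suc x) f = lower d x f

lower-≤ : ∀ {d x} f → d ℕ.≤ x → lower d x f ≡ f (x ∸ d)
lower-≤ {zero}          f d≤x         = refl
lower-≤ {suc d} {suc x} f (ℕ.s≤s d≤x) = lower-≤ f d≤x

lower-< : ∀ {d x} f → x ℕ.< d → lower d x f ≡ 0
lower-< {suc d} {zero}  f x<d         = refl
lower-< {suc d} {suc x} f (ℕ.s≤s x<d) = lower-< f x<d

lower-cong : ∀ d x {f g : ℕ → ℕ} → (∀ y → f y ≡ g y) → lower d x f ≡ lower d x g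
lower-cong zero    x       f≗g = f≗g x
lower-cong (suc d) zero    f≗g = refl
lower-cong (suc d) (suc x) f≗g = lower-cong d x f≗g

lower-+ : ∀ d x (f g : ℕ → ℕ) → lower d x (λ y → f y ℕ.+ g y) ≡ lower d x f ℕ.+ lower d x g
lower-+ zero    x       f g = refl
lower-+ (suc d) zero    f g = refl
lower-+ (suc d) (suc x) f g = lower-+ d x f g

lower-const-0 : ∀ d x → lower d x (λ _ → 0) ≡ 0
lower-const-0 zero    x       = refl
lower-const-0 (suc d) zero    = refl
lower-const-0 (suc d) (suc x) = lower-const-0 d x

lower-comm : ∀ d x e z (h : ℕ → ℕ → ℕ) →
  lower d x (λ y → lower e z (h y)) ≡ lower e z (λ w → lower d x (λ y → h y w))
lower-comm zero    x       e z h = refl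
lower-comm (suc d) zero    e z h = sym (lower-const-0 e z)
lower-comm (suc d) (suc x) e z h = lower-comm d x e z h

-- Paths of L steps U = (1, 1), D = (1, −K) from height a to height b with n steps D, never below 0.
walks : ℕ → ℕ → ℕ → ℕ → ℕ → ℕ
walks K zero    a b n = if (n ℕ.≡ᵇ 0) ∧ (a ℕ.≡ᵇ b) then 1 else 0
walks K (suc L) a b n = walks K L (suc a) b n ℕ.+ lower K a (λ a′ → lower 1 n (walks K L a′ b))

walks-zero-lower : ∀ K d a b n → lower d a (λ a′ → walks K 0 a′ b n) ≡ walks K 0 a (d ℕ.+ b) n
walks-zero-lower K zero    a       b n       = refl
walks-zero-lower K (suc d) zero    b zero    = refl
walks-zero-lower K (suc d) zero    b (suc n) = refl
walks-zero-lower K (suc d) (suc a) b zero    = walks-zero-lower K d a b zero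
walks-zero-lower K (suc d) (suc a) b (suc n) = walks-zero-lower K d a b (suc n)

walks-last : ∀ K L a b n →
  walks K (suc L) a b n ≡ lower 1 b (λ b′ → walks K L a b′ n) ℕ.+ lower 1 n (walks K L a (K ℕ.+ b))
walks-last K zero a zero    zero    = cong (0 ℕ.+_) (lower-const-0 K a)
walks-last K zero a (suc b) zero    = cong (walks K 0 a b 0 ℕ.+_) (lower-const-0 K a)
walks-last K zero a b       (suc n) =
  trans (walks-zero-lower K K a b n) (cong (ℕ._+ walks K 0 a (K ℕ.+ b) n) (sym (lower-const-0 1 b)))
walks-last K (suc L) a b n = begin
  walks K (suc L) (suc a) b n ℕ.+ lower K a (λ a′ → lower 1 n (walks K (suc L) a′ b))
    ≡⟨ cong₂ ℕ._+_ (walks-last K L (suc a) b n)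
                   (lower-cong K a (λ a′ → lower-cong 1 n (λ m → walks-last K L a′ b m))) ⟩
  (P ℕ.+ X) ℕ.+ lower K a (λ a′ → lower 1 n (λ m → Q′ a′ m ℕ.+ Y′ a′ m))
    ≡⟨ cong ((P ℕ.+ X) ℕ.+_) (trans (lower-cong K a (λ a′ → lower-+ 1 n (Q′ a′) (Y′ a′)))
                                   (lower-+ K a (λ a′ → lower 1 n (Q′ a′)) (λ a′ → lower 1 n (Y′ a′)))) ⟩
  (P ℕ.+ X) ℕ.+ (lower K a (λ a′ → lower 1 n (Q′ a′)) ℕ.+ lower K a (λ a′ → lower 1 n (Y′ a′)))
    ≡⟨ cong₂ (λ q y → (P ℕ.+ X) ℕ.+ (q ℕ.+ y)) Q′≡Q (lower-comm K a 1 n Y′) ⟩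
  (P ℕ.+ X) ℕ.+ (Q ℕ.+ Y)
    ≡⟨ interchange P X Q Y ⟩
  (P ℕ.+ Q) ℕ.+ (X ℕ.+ Y)
    ≡⟨ cong₂ ℕ._+_ (lower-+ 1 b _ _) (lower-+ 1 n _ _) ⟨
  lower 1 b (λ b′ → walks K (suc L) a b′ n) ℕ.+ lower 1 n (walks K (suc L) a (K ℕ.+ b)) ∎
  where
  P = lower 1 b (λ b′ → walks K L (suc a) b′ n)
  X = lower 1 n (walks K L (suc a) (K ℕ.+ b))
  Q′ Y′ : ℕ → ℕ → ℕ
  Q′ a′ m = lower 1 b (λ b′ → walks K L a′ b′ m)
  Y′ a′ m = lower 1 m (walks K L a′ (K ℕ.+ b))
  Q = lower 1 b (λ b′ → lower K a (λ a′ → lower 1 n (walks K L a′ b′)))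
  Y = lower 1 n (λ m → lower K a (λ a′ → Y′ a′ m))
  Q′≡Q : lower K a (λ a′ → lower 1 n (Q′ a′)) ≡ Q
  Q′≡Q = trans (lower-cong K a (λ a′ → lower-comm 1 n 1 b (λ m b′ → walks K L a′ b′ m)))
               (lower-comm K a 1 b (λ a′ b′ → lower 1 n (walks K L a′ b′)))
  interchange : ∀ p x q y → (p ℕ.+ x) ℕ.+ (q ℕ.+ y) ≡ (p ℕ.+ q) ℕ.+ (x ℕ.+ y)
  interchange = ℕ-Solver.solve-∀

≤ᵇ∧≥ᵇ≡≡ᵇ : ∀ a b → (a ℕ.≤ᵇ b) ∧ (b ℕ.≤ᵇ a) ≡ (a ℕ.≡ᵇ b)
≤ᵇ∧≥ᵇ≡≡ᵇ zero    zero    = refl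
≤ᵇ∧≥ᵇ≡≡ᵇ zero    (suc b) = refl
≤ᵇ∧≥ᵇ≡≡ᵇ (suc a) zero    = refl
≤ᵇ∧≥ᵇ≡≡ᵇ (suc a) (suc b) = trans (cong₂ _∧_ (<ᵇ-suc≡≤ᵇ a b) (<ᵇ-suc≡≤ᵇ b a)) (≤ᵇ∧≥ᵇ≡≡ᵇ a b)
  where
  <ᵇ-suc≡≤ᵇ : ∀ a b → (a ℕ.<ᵇ suc b) ≡ (a ℕ.≤ᵇ b)
  <ᵇ-suc≡≤ᵇ zero    b = refl
  <ᵇ-suc≡≤ᵇ (suc a) b = refl

height-after-D : ∀ K a → + a + δ (suc K) D ≡ a ℤ.⊖ K
height-after-D K a = begin
  + a + (+ 1 - + suc K)   ≡⟨ cong (λ x → + a + (+ 1 - x)) (ℤₚ.pos-+ 1 K) ⟩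
  + a + (+ 1 - (+ 1 + + K)) ≡⟨ cancel (+ a) (+ K) ⟩
  + a - + K               ≡⟨ ℤₚ.[+m]-[+n]≡m⊖n a K ⟩
  a ℤ.⊖ K                 ∎
  where
  cancel : ∀ a k → a + (+ 1 - (+ 1 + k)) ≡ a - k
  cancel = ℤ-Solver.solve-∀

0≤ᵇ⊖-< : ∀ {a K} → a ℕ.< K → (+ 0 ℤ.≤ᵇ (a ℤ.⊖ K)) ≡ false
0≤ᵇ⊖-< {zero}  {suc K} a<K         = refl
0≤ᵇ⊖-< {suc a} {suc K} (ℕ.s≤s a<K) = trans (cong (+ 0 ℤ.≤ᵇ_) (ℤₚ.[1+m]⊖[1+n]≡m⊖n a K)) (0≤ᵇ⊖-< a<K)

count-D-first : ∀ K a b n ws →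
  length (filterᵇ (λ w → isDyck (suc K) n a b (D ∷ w)) ws)
    ≡ lower K a (λ a′ → lower 1 n (λ m → length (filterᵇ (isDyck (suc K) m a′ b) ws)))
count-D-first K a b n ws with K ℕ.≤? a
... | no K≰a = trans (length-filterᵇ-none too-low ws) (sym (lower-< _ (ℕₚ.≰⇒> K≰a)))
  where
  too-low : ∀ w → isDyck (suc K) n a b (D ∷ w) ≡ false
  too-low w rewrite height-after-D K a | 0≤ᵇ⊖-< (ℕₚ.≰⇒> K≰a) = refl
... | yes K≤a = trans (count n) (sym (lower-≤ _ K≤a))
  where
  lands : + a + δ (suc K) D ≡ + (a ∸ K)
  lands = trans (height-after-D K a) (ℤₚ.⊖-≥ K≤a)
  count : ∀ n → length (filterᵇ (λ w → isDyck (suc K) n a b (D ∷ w)) ws)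
                  ≡ lower 1 n (λ m → length (filterᵇ (isDyck (suc K) m (a ∸ K) b) ws))
  count zero    = length-filterᵇ-none (λ w → Boolₚ.∧-zeroʳ _) ws
  count (suc m) = length-filterᵇ-cong (λ w →
    cong (λ h → ((+ 0 ℤ.≤ᵇ h) ∧ staysAboveEndsAt (suc K) h (+ b) w) ∧ (countD w ℕ.≡ᵇ m)) lands) ws

count≡walks : ∀ K L a b n → length (filterᵇ (isDyck (suc K) n a b) (words L)) ≡ walks K L a b n
count≡walks K zero a b n =
  trans (length-filterᵇ-[x] (isDyck (suc K) n a b) []) (cong (λ c → if c then 1 else 0) empty-path)
  where
  0≡ᵇ : ∀ n → (0 ℕ.≡ᵇ n) ≡ (n ℕ.≡ᵇ 0)
  0≡ᵇ zero    = refl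
  0≡ᵇ (suc n) = refl
  empty-path : isDyck (suc K) n a b [] ≡ (n ℕ.≡ᵇ 0) ∧ (a ℕ.≡ᵇ b)
  empty-path = begin
    ((a ℕ.≤ᵇ b) ∧ (b ℕ.≤ᵇ a)) ∧ (0 ℕ.≡ᵇ n) ≡⟨ cong₂ _∧_ (≤ᵇ∧≥ᵇ≡≡ᵇ a b) (0≡ᵇ n) ⟩
    (a ℕ.≡ᵇ b) ∧ (n ℕ.≡ᵇ 0)               ≡⟨ Boolₚ.∧-comm (a ℕ.≡ᵇ b) (n ℕ.≡ᵇ 0) ⟩
    (n ℕ.≡ᵇ 0) ∧ (a ℕ.≡ᵇ b)               ∎
count≡walks K (suc L) a b n = begin
  length (filterᵇ P (map (U ∷_) ws ++ map (D ∷_) ws))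
    ≡⟨ length-filterᵇ-++ P (map (U ∷_) ws) (map (D ∷_) ws) ⟩
  length (filterᵇ P (map (U ∷_) ws)) ℕ.+ length (filterᵇ P (map (D ∷_) ws))
    ≡⟨ cong₂ ℕ._+_ (length-filterᵇ-map P (U ∷_) ws) (length-filterᵇ-map P (D ∷_) ws) ⟩
  length (filterᵇ (P ∘ (U ∷_)) ws) ℕ.+ length (filterᵇ (P ∘ (D ∷_)) ws)
    ≡⟨ cong₂ ℕ._+_ (length-filterᵇ-cong (λ w → cong (λ x → isDyck (suc K) n x b w) (ℕₚ.+-comm a 1)) ws)
                   (count-D-first K a b n ws) ⟩
  length (filterᵇ (isDyck (suc K) n (suc a) b) ws)
    ℕ.+ lower K a (λ a′ → lower 1 n (λ m → length (filterᵇ (isDyck (suc K) m a′ b) ws)))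
    ≡⟨ cong₂ ℕ._+_ (count≡walks K L (suc a) b n)
                   (lower-cong K a (λ a′ → lower-cong 1 n (λ m → count≡walks K L a′ b m))) ⟩
  walks K (suc L) a b n ∎
  where
  P = isDyck (suc K) n a b
  ws = words L

<ᵇ-true : ∀ {m n} → m ℕ.< n → (m ℕ.<ᵇ n) ≡ true
<ᵇ-true {zero}  {suc n} _           = refl
<ᵇ-true {suc m} {suc n} (ℕ.s≤s m<n) = <ᵇ-true m<n

<ᵇ-false : ∀ {m n} → n ℕ.≤ m → (m ℕ.<ᵇ n) ≡ false
<ᵇ-false {m}     {zero}  _           = refl
<ᵇ-false {suc m} {suc n} (ℕ.s≤s n≤m) = <ᵇ-false n≤m

walks-no-down : ∀ K L a → walks K L a (a ℕ.+ L) 0 ≡ 1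
walks-no-down K zero    a rewrite ℕₚ.+-identityʳ a | Equivalence.to Boolₚ.T-≡ (ℕₚ.≡⇒≡ᵇ a a refl) = refl
walks-no-down K (suc L) a rewrite ℕₚ.+-suc a L | lower-const-0 K a | ℕₚ.+-identityʳ (walks K L (suc a) (suc a ℕ.+ L) 0) =
  walks-no-down K L (suc a)

guardedWalks : ℕ → ℕ → ℕ → ℕ → ℕ → ℕ
guardedWalks K S α β n = if S ℕ.<ᵇ α then 0 else walks K (S ∸ α) α β n

dyckCount≡guardedWalks : ∀ K n α β → dyckCount (suc K) n α β ≡ guardedWalks K (suc K ℕ.* n ℕ.+ β) α β n
dyckCount≡guardedWalks K n α β =
  cong (λ x → if suc K ℕ.* n ℕ.+ β ℕ.<ᵇ α then 0 else x) (count≡walks K (suc K ℕ.* n ℕ.+ β ∸ α) α β n)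

guardedWalks-no-down : ∀ K α β → guardedWalks K β α β 0 ≡ (if β ℕ.<ᵇ α then 0 else 1)
guardedWalks-no-down K α β with α ℕ.≤? β
... | yes α≤β rewrite <ᵇ-false α≤β =
  trans (cong (λ b → walks K (β ∸ α) α b 0) (sym (ℕₚ.m+[n∸m]≡n α≤β))) (walks-no-down K (β ∸ α) α)
... | no α≰β rewrite <ᵇ-true (ℕₚ.≰⇒> α≰β) = refl

guardedWalks-last : ∀ K S α b m →
  guardedWalks K (suc S) α b (suc m)
    ≡ lower 1 b (λ b′ → guardedWalks K S α b′ (suc m)) ℕ.+ guardedWalks K S α (K ℕ.+ b) m
guardedWalks-last K S α b m with α ℕ.≤? S
... | yes α≤S rewrite <ᵇ-false α≤S | <ᵇ-false (ℕₚ.m≤n⇒m≤1+n α≤S) | ℕₚ.+-∸-assoc 1 α≤S =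
  walks-last K (S ∸ α) α b (suc m)
... | no α≰S rewrite <ᵇ-true (ℕₚ.≰⇒> α≰S) | lower-const-0 1 b = empty (ℕₚ.≰⇒> α≰S)
  where
  empty : S ℕ.< α → guardedWalks K (suc S) α b (suc m) ≡ 0
  empty S<α with suc S ℕ.<ᵇ α
  ... | true  = refl
  ... | false rewrite ℕₚ.m≤n⇒m∸n≡0 S<α = refl

dyckCount-suc-suc : ∀ K n α b →
  dyckCount (suc K) (suc n) α (suc b) ≡ dyckCount (suc K) (suc n) α b ℕ.+ dyckCount (suc K) n α (K ℕ.+ suc b)
dyckCount-suc-suc K n α b = begin
  dyckCount (suc K) (suc n) α (suc b)
    ≡⟨ dyckCount≡guardedWalks K (suc n) α (suc b) ⟩
  guardedWalks K (suc K ℕ.* suc n ℕ.+ suc b) α (suc b) (suc n)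
    ≡⟨ cong (λ S → guardedWalks K S α (suc b) (suc n)) (ℕₚ.+-suc (suc K ℕ.* suc n) b) ⟩
  guardedWalks K (suc S) α (suc b) (suc n)
    ≡⟨ guardedWalks-last K S α (suc b) n ⟩
  guardedWalks K S α b (suc n) ℕ.+ guardedWalks K S α (K ℕ.+ suc b) n
    ≡⟨ cong₂ ℕ._+_ (sym (dyckCount≡guardedWalks K (suc n) α b))
                   (trans (cong (λ S → guardedWalks K S α (K ℕ.+ suc b) n) (e K n b))
                          (sym (dyckCount≡guardedWalks K n α (K ℕ.+ suc b)))) ⟩
  dyckCount (suc K) (suc n) α b ℕ.+ dyckCount (suc K) n α (K ℕ.+ suc b) ∎
  where
  S = suc K ℕ.* suc n ℕ.+ b
  e : ∀ K n b → suc K ℕ.* suc n ℕ.+ b ≡ suc K ℕ.* n ℕ.+ (K ℕ.+ suc b)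
  e = ℕ-Solver.solve-∀

dyckCount-suc-zero : ∀ K n α → dyckCount (suc K) (suc n) α 0 ≡ dyckCount (suc K) n α K
dyckCount-suc-zero K n α = begin
  dyckCount (suc K) (suc n) α 0
    ≡⟨ dyckCount≡guardedWalks K (suc n) α 0 ⟩
  guardedWalks K (suc K ℕ.* suc n ℕ.+ 0) α 0 (suc n)
    ≡⟨ cong (λ S → guardedWalks K S α 0 (suc n)) (e K n) ⟩
  guardedWalks K (suc S) α 0 (suc n)
    ≡⟨ guardedWalks-last K S α 0 n ⟩
  guardedWalks K S α (K ℕ.+ 0) n
    ≡⟨ cong (λ b → guardedWalks K S α b n) (ℕₚ.+-identityʳ K) ⟩
  guardedWalks K S α K n
    ≡⟨ dyckCount≡guardedWalks K n α K ⟨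
  dyckCount (suc K) n α K ∎
  where
  S = suc K ℕ.* n ℕ.+ K
  e : ∀ K n → suc K ℕ.* suc n ℕ.+ 0 ≡ suc (suc K ℕ.* n ℕ.+ K)
  e = ℕ-Solver.solve-∀

dyckCount-zero : ∀ K α β → dyckCount (suc K) 0 α β ≡ (if β ℕ.<ᵇ α then 0 else 1)
dyckCount-zero K α β = begin
  dyckCount (suc K) 0 α β                   ≡⟨ dyckCount≡guardedWalks K 0 α β ⟩
  guardedWalks K (suc K ℕ.* 0 ℕ.+ β) α β 0   ≡⟨ cong (λ S → guardedWalks K S α β 0) (e K β) ⟩
  guardedWalks K β α β 0                    ≡⟨ guardedWalks-no-down K α β ⟩
  (if β ℕ.<ᵇ α then 0 else 1)               ∎
  where
  e : ∀ K β → suc K ℕ.* 0 ℕ.+ β ≡ β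
  e = ℕ-Solver.solve-∀

record DyckRecurrence (K : ℕ) (f : ℕ → ℕ → ℤ) : Set where
  field
    suc-suc  : ∀ n b → f (suc n) (suc b) ≡ f (suc n) b + f n (K ℕ.+ suc b)
    suc-zero : ∀ n → f (suc n) 0 ≡ f n K

DyckRecurrence-unique : ∀ {K f g} → DyckRecurrence K f → DyckRecurrence K g →
  (∀ β → f 0 β ≡ g 0 β) → ∀ n β → f n β ≡ g n β
DyckRecurrence-unique F G f≗g zero β = f≗g β
DyckRecurrence-unique {K} F G f≗g (suc n) zero =
  trans (F.suc-zero n) (trans (DyckRecurrence-unique F G f≗g n K) (sym (G.suc-zero n)))
  where module F = DyckRecurrence F; module G = DyckRecurrence G
DyckRecurrence-unique {K} F G f≗g (suc n) (suc b) =
  trans (F.suc-suc n b)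
        (trans (cong₂ _+_ (DyckRecurrence-unique F G f≗g (suc n) b) (DyckRecurrence-unique F G f≗g n (K ℕ.+ suc b)))
               (sym (G.suc-suc n b)))
  where module F = DyckRecurrence F; module G = DyckRecurrence G

dyckCount-recurrence : ∀ K α → DyckRecurrence K (λ n β → + dyckCount (suc K) n α β)
dyckCount-recurrence K α = record
  { suc-suc  = λ n b → trans (cong +_ (dyckCount-suc-suc K n α b)) (ℤₚ.pos-+ (dyckCount (suc K) (suc n) α b) _)
  ; suc-zero = λ n → cong +_ (dyckCount-suc-zero K n α)
  }

rhsℤ-recurrence : ∀ K α → DyckRecurrence K (λ n β → rhsℤ K n α β)
rhsℤ-recurrence K α = record
  { suc-suc  = λ n b → rhsℤ-suc-suc K n α b
  ; suc-zero = λ n → rhsℤ-suc-zero K n α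
  }

-- k ≥ 2 only excludes k = 0: the identity holds for k = 1 as well.
theorem2p3 : (k n α β : ℕ) → k ≥ 2 → (+ dyckCount k n α β) / 1 ≡ rhs k n α β
theorem2p3 zero    n α β ()
theorem2p3 (suc K) n α β _ = begin
  fromℤ (+ dyckCount (suc K) n α β)
    ≡⟨ cong fromℤ (DyckRecurrence-unique (dyckCount-recurrence K α) (rhsℤ-recurrence K α) same-start n β) ⟩
  fromℤ (rhsℤ K n α β)
    ≡⟨ rhs≡fromℤ-rhsℤ K n α β ⟨
  rhs (suc K) n α β ∎
  where
  same-start : ∀ β → + dyckCount (suc K) 0 α β ≡ rhsℤ K 0 α β
  same-start β = trans (cong +_ (dyckCount-zero K α β)) (sym (rhsℤ-zero K α β))
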